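{- Let $G$ be a connected graph of order $n$. Then $mvd(G)=n$ if and only if every block of $G$ is a complete graph.
   Context: A block of $G$ is a maximal connected subgraph of $G$ that has no cut-vertex. For a vertex-colored graph and two nonadjacent vertices $x,y$, an $x$-$y$ vertex cut is a set $S\subseteq V(G)\setminus\{x,y\}$ such that $x$ and $y$ lie in different components of $G-S$; it is monochromatic if all its vertices have the same color. A vertex-coloring is an MVD-coloring if every pair of nonadjacent vertices has a monochromatic vertex cut separating them. $mvd(G)$ is the maximum number of colors used by an MVD-coloring of $G$. -}

module Defs where

open import Data.Nat using (ℕ; _≤_)
open import Data.Bool using (Bool; true; false; T)
open import Data.Fin using (Fin)
open import Data.Product using (Σ; ∃; _×_; _,_)
open import Data.Empty using (⊥)
open import Level using (0ℓ)
open import Relation.Nullary using (¬_)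
open import Relation.Unary using (Pred; _∈_; _∉_; _⊆_; _∩_; ∁; ｛_｝; U)
open import Relation.Binary.PropositionalEquality using (_≡_; _≢_)
open import Function.Definitions using (Surjective)

record Graph (n : ℕ) : Set where
  field
    adj    : Fin n → Fin n → Bool
    sym    : ∀ u v → adj u v ≡ adj v u
    irrefl : ∀ v → adj v v ≡ false

open Graph public

VSet : ℕ → Set₁
VSet n = Pred (Fin n) 0ℓ

Adj : ∀ {n} → Graph n → Fin n → Fin n → Set
Adj G u v = T (adj G u v)

data Reach {n : ℕ} (G : Graph n) (S : VSet n) : Fin n → Fin n → Set where
  here : ∀ {x} → x ∈ S → Reach G S x x
  step : ∀ {x y z} → x ∈ S → Adj G x y → Reach G S y z → Reach G S x z

ConnectedOn : ∀ {n} → Graph n → VSet n → Set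
ConnectedOn G S = (∃ λ v → v ∈ S) × (∀ x y → x ∈ S → y ∈ S → Reach G S x y)

Connected : ∀ {n} → Graph n → Set
Connected G = ConnectedOn G U

-- G[S] has no cut-vertex: removing any single vertex of G[S] leaves it connected
-- (in the sense of not increasing the number of components; here G[S] is connected).
-- Removing a vertex from K₁ leaves the empty graph, which is counted as connected here.
NoCutVertexOn : ∀ {n} → Graph n → VSet n → Set
NoCutVertexOn G S =
  ∀ v → v ∈ S → ∀ x y → x ∈ S → y ∈ S → x ≢ v → y ≢ v →
    Reach G (S ∩ ∁ ｛ v ｝) x y

Nonseparable : ∀ {n} → Graph n → VSet n → Set
Nonseparable G S = ConnectedOn G S × NoCutVertexOn G S

IsBlock : ∀ {n} → Graph n → VSet n → Set₁
IsBlock {n} G B =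
  Nonseparable G B × (∀ (B' : VSet n) → B ⊆ B' → Nonseparable G B' → B' ⊆ B)

CompleteOn : ∀ {n} → Graph n → VSet n → Set
CompleteOn G B = ∀ x y → x ∈ B → y ∈ B → x ≢ y → Adj G x y

IsVertexCut : ∀ {n} → Graph n → Fin n → Fin n → VSet n → Set
IsVertexCut G x y S = x ∉ S × y ∉ S × ¬ Reach G (∁ S) x y

Monochromatic : ∀ {n k} → (Fin n → Fin k) → VSet n → Set
Monochromatic {k = k} c S = ∃ λ (col : Fin k) → ∀ v → v ∈ S → c v ≡ col

IsMVDColoring : ∀ {n k} → Graph n → (Fin n → Fin k) → Set₁
IsMVDColoring {n} G c =
  ∀ x y → x ≢ y → ¬ Adj G x y →
    Σ (VSet n) λ S → IsVertexCut G x y S × Monochromatic c S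

HasMVDColoringWith : ∀ {n} → Graph n → ℕ → Set₁
HasMVDColoringWith {n} G k =
  Σ (Fin n → Fin k) λ c → Surjective _≡_ _≡_ c × IsMVDColoring G c

IsMVD : ∀ {n} → Graph n → ℕ → Set₁
IsMVD G k = HasMVDColoringWith G k × (∀ m → HasMVDColoringWith G m → m ≤ k)

-- An MVD-colouring with n colours is injective, so its monochromatic cuts have at most one
-- vertex; a block survives the removal of one vertex, so two of its vertices are never
-- separated and must be adjacent. Conversely, if all blocks are complete, follow a simple
-- path from x to a nonadjacent y up to the step x ∼ p ∼ q with x ≁ q. If x and y were
-- joined in G − p, then x and q would lie on a cycle through p and hence in a common block,
-- forcing x ∼ q; so {p} is a cut, and the identity colouring is an MVD-colouring.

module Submission where

open import Defs hiding (sym)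
open import Data.Nat using (ℕ; zero; suc; _≤_)
open import Data.Nat.Properties using (<-irrefl)
open import Data.Bool using (Bool; T)
open import Data.Unit using (⊤; tt)
open import Data.Empty using (⊥-elim)
open import Data.Fin using (Fin; punchIn; punchOut) renaming (_≟_ to _≟ᶠ_)
open import Data.Fin.Properties using (injective⇒≤; punchIn-punchOut)
open import Data.Product using (Σ; ∃; _×_; _,_; proj₁; proj₂)
open import Data.Sum using (_⊎_; inj₁; inj₂; [_,_])
open import Function using (_∘_)
open import Function.Bundles using (_⇔_; mk⇔)
open import Function.Definitions using (Surjective; Injective)
open import Relation.Nullary using (¬_; Dec; yes; no)
open import Relation.Nullary.Decidable
  using (decidable-stable; ¬¬-excluded-middle; isYes; toWitness; fromWitness; T?)
open import Relation.Unary using (Decidable; _∈_; _∉_; _⊆_; _≐_; _∩_; _∪_; ∁; ｛_｝; U)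
open import Relation.Unary.Properties using (_∪?_)
open import Relation.Binary.PropositionalEquality using (_≡_; _≢_; refl; sym; trans; cong; subst)

¬¬-decidable : ∀ {n} (Q : VSet n) → ¬ ¬ Decidable Q
¬¬-decidable {zero}  Q k = k λ ()
¬¬-decidable {suc n} Q k = ¬¬-excluded-middle λ Q0? →
  ¬¬-decidable (Q ∘ Fin.suc) λ Qs? → k λ { Fin.zero → Q0? ; (Fin.suc i) → Qs? i }

surjective⇒≤ : ∀ {m n} (c : Fin m → Fin n) → Surjective _≡_ _≡_ c → n ≤ m
surjective⇒≤ c surj = injective⇒≤ section-injective
  where
  section-injective : Injective _≡_ _≡_ (proj₁ ∘ surj)
  section-injective {a} {b} e =
    trans (sym (proj₂ (surj a) refl)) (trans (cong c e) (proj₂ (surj b) refl))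

-- If c s ≡ c w with s ≢ w, then c ∘ punchIn s : Fin (n - 1) → Fin n is still onto.
surjective⇒injective : ∀ {n} (c : Fin n → Fin n) → Surjective _≡_ _≡_ c → Injective _≡_ _≡_ c
surjective⇒injective {suc n} c surj {s} {w} cs≡cw with s ≟ᶠ w
... | yes s≡w = s≡w
... | no s≢w  = ⊥-elim (<-irrefl refl (surjective⇒≤ (c ∘ punchIn s) surj′))
  where
  surj′ : Surjective _≡_ _≡_ (c ∘ punchIn s)
  surj′ y with x , cx≡y ← surj y | s ≟ᶠ x
  ... | yes refl = punchOut s≢w , λ { refl →
          trans (cong c (punchIn-punchOut s≢w)) (trans (sym cs≡cw) (cx≡y refl)) }
  ... | no s≢x = punchOut s≢x , λ { refl → trans (cong c (punchIn-punchOut s≢x)) (cx≡y refl) }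

module _ {n : ℕ} (G : Graph n) where

  Adj-sym : ∀ {x y} → Adj G x y → Adj G y x
  Adj-sym {x} {y} = subst T (Graph.sym G x y)

  Adj-irrefl : ∀ {x} → ¬ Adj G x x
  Adj-irrefl {x} = subst T (irrefl G x)

  source-∈ : ∀ {S x y} → Reach G S x y → x ∈ S
  source-∈ (here x∈S)     = x∈S
  source-∈ (step x∈S _ _) = x∈S

  target-∈ : ∀ {S x y} → Reach G S x y → y ∈ S
  target-∈ (here y∈S)   = y∈S
  target-∈ (step _ _ r) = target-∈ r

  infix 4 _∈ʷ_ _∈ʷ?_

  _∈ʷ_ : ∀ {S x y} → Fin n → Reach G S x y → Set
  z ∈ʷ here {x} _     = z ≡ x
  z ∈ʷ step {x} _ _ r = z ≡ x ⊎ z ∈ʷ r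

  _∈ʷ?_ : ∀ {S x y} z (r : Reach G S x y) → Dec (z ∈ʷ r)
  z ∈ʷ? here {x} _ = z ≟ᶠ x
  z ∈ʷ? step {x} _ _ r with z ≟ᶠ x | z ∈ʷ? r
  ... | yes z≡x | _        = yes (inj₁ z≡x)
  ... | no _    | yes z∈r  = yes (inj₂ z∈r)
  ... | no z≢x  | no z∉r   = no [ z≢x , z∉r ]

  Vertices : ∀ {S x y} → Reach G S x y → VSet n
  Vertices r z = z ∈ʷ r

  source-∈ʷ : ∀ {S x y} (r : Reach G S x y) → x ∈ʷ r
  source-∈ʷ (here _)     = refl
  source-∈ʷ (step _ _ _) = inj₁ refl

  target-∈ʷ : ∀ {S x y} (r : Reach G S x y) → y ∈ʷ r
  target-∈ʷ (here _)     = refl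
  target-∈ʷ (step _ _ r) = inj₂ (target-∈ʷ r)

  Vertices⊆ : ∀ {S x y} (r : Reach G S x y) → Vertices r ⊆ S
  Vertices⊆ (here x∈S)     refl        = x∈S
  Vertices⊆ (step x∈S _ _) (inj₁ refl) = x∈S
  Vertices⊆ (step _ _ r)   (inj₂ z∈r)  = Vertices⊆ r z∈r

  restrict : ∀ {S S′ x y} (r : Reach G S x y) → Vertices r ⊆ S′ → Reach G S′ x y
  restrict (here _)     r⊆S′ = here (r⊆S′ refl)
  restrict (step _ a r) r⊆S′ = step (r⊆S′ (inj₁ refl)) a (restrict r (r⊆S′ ∘ inj₂))

  Reach-mono : ∀ {S S′ x y} → S ⊆ S′ → Reach G S x y → Reach G S′ x y
  Reach-mono S⊆S′ r = restrict r (S⊆S′ ∘ Vertices⊆ r)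

  infixr 5 _++_

  _++_ : ∀ {S x y z} → Reach G S x y → Reach G S y z → Reach G S x z
  here _     ++ r′ = r′
  step p a r ++ r′ = step p a (r ++ r′)

  snoc : ∀ {S x y z} → Reach G S x y → Adj G y z → z ∈ S → Reach G S x z
  snoc r a z∈S = r ++ step (target-∈ r) a (here z∈S)

  reverse : ∀ {S x y} → Reach G S x y → Reach G S y x
  reverse (here x∈S)     = here x∈S
  reverse (step x∈S a r) = snoc (reverse r) (Adj-sym a) x∈S

  suffix : ∀ {S x y u} (r : Reach G S x y) → u ∈ʷ r → Reach G (Vertices r) u y
  suffix (here _)       refl       = here refl
  suffix r@(step _ _ _) (inj₁ refl) = restrict r (λ z∈r → z∈r)
  suffix (step _ _ r)   (inj₂ u∈r) = Reach-mono inj₂ (suffix r u∈r)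

  Simple : ∀ {S x y} → Reach G S x y → Set
  Simple (here _)         = ⊤
  Simple (step {x} _ _ r) = x ∉ Vertices r × Simple r

  dropUntil : ∀ {S u y x} (r : Reach G S u y) → x ∈ʷ r → Simple r → Σ (Reach G S x y) Simple
  dropUntil r@(here _)     refl        s       = r , s
  dropUntil r@(step _ _ _) (inj₁ refl) s       = r , s
  dropUntil (step _ _ r)   (inj₂ x∈r)  (_ , s) = dropUntil r x∈r s

  simplify : ∀ {S x y} → Reach G S x y → Σ (Reach G S x y) Simple
  simplify (here p) = here p , tt
  simplify (step {x} p a r) with r′ , s′ ← simplify r | x ∈ʷ? r′
  ... | yes x∈r′ = dropUntil r′ x∈r′ s′
  ... | no x∉r′  = step p a r′ , x∉r′ , s′

  reach-end-avoiding : ∀ {S a z u w} (r : Reach G S a z) → Simple r → u ∈ʷ r → w ∈ʷ r → u ≢ w →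
    Reach G (Vertices r ∩ ∁ ｛ w ｝) u a ⊎ Reach G (Vertices r ∩ ∁ ｛ w ｝) u z
  reach-end-avoiding (here _) _ refl refl u≢w = ⊥-elim (u≢w refl)
  reach-end-avoiding (step _ _ _) _ (inj₁ refl) _ u≢w = inj₁ (here (inj₁ refl , u≢w ∘ sym))
  reach-end-avoiding (step _ _ r) (a∉r , _) (inj₂ u∈r) (inj₁ refl) _ =
    inj₂ (Reach-mono (λ t∈r → inj₂ t∈r , λ { refl → a∉r t∈r }) (suffix r u∈r))
  reach-end-avoiding (step _ e r) (a∉r , s) (inj₂ u∈r) (inj₂ w∈r) u≢w
    with reach-end-avoiding r s u∈r w∈r u≢w
  ... | inj₁ u⇝b = inj₁ (snoc (Reach-mono (λ (t∈r , t≢w) → inj₂ t∈r , t≢w) u⇝b) (Adj-sym e)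
                           (inj₁ refl , λ { refl → a∉r w∈r }))
  ... | inj₂ u⇝z = inj₂ (Reach-mono (λ (t∈r , t≢w) → inj₂ t∈r , t≢w) u⇝z)

  Nonseparable-resp-≐ : ∀ {S S′ : VSet n} → S ≐ S′ → Nonseparable G S → Nonseparable G S′
  Nonseparable-resp-≐ (S⊆S′ , S′⊆S) (((v , v∈S) , conn) , nocut) =
    ((v , S⊆S′ v∈S) , λ a b a∈ b∈ → Reach-mono S⊆S′ (conn a b (S′⊆S a∈) (S′⊆S b∈))) ,
    λ w w∈ a b a∈ b∈ a≢w b≢w → Reach-mono (λ (t∈ , t≢w) → S⊆S′ t∈ , t≢w)
      (nocut w (S′⊆S w∈) a b (S′⊆S a∈) (S′⊆S b∈) a≢w b≢w)

  BlocksComplete : Set₁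
  BlocksComplete = ∀ B → IsBlock G B → CompleteOn G B

  subsingleton-not-cut : ∀ {B S x y} → Nonseparable G B → x ∈ B → y ∈ B →
    (∀ {s t} → s ∈ S → t ∈ S → s ≡ t) → ¬ IsVertexCut G x y S
  subsingleton-not-cut {B} {S} {x} {y} ((_ , conn) , nocut) x∈B y∈B subsingleton
                       (x∉S , y∉S , ¬x⇝y) =
    ¬¬-excluded-middle {A = ∃ λ w → w ∈ S × w ∈ B} λ where
      (yes (w , w∈S , w∈B)) → ¬x⇝y (Reach-mono (λ (_ , w≢t) t∈S → w≢t (subsingleton w∈S t∈S))
        (nocut w w∈B x y x∈B y∈B (λ { refl → x∉S w∈S }) (λ { refl → y∉S w∈S })))
      (no ∄w) → ¬x⇝y (Reach-mono (λ t∈B t∈S → ∄w (_ , t∈S , t∈B)) (conn x y x∈B y∈B))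

  monochromatic-subsingleton : ∀ {k S} {c : Fin n → Fin k} → Injective _≡_ _≡_ c →
    Monochromatic c S → ∀ {s t} → s ∈ S → t ∈ S → s ≡ t
  monochromatic-subsingleton injective (_ , colour) s∈S t∈S =
    injective (trans (colour _ s∈S) (sym (colour _ t∈S)))

  mvd⇒blocks-complete : IsMVD G n → BlocksComplete
  mvd⇒blocks-complete ((c , surjective , mvd) , _) B (nonsep , _) x y x∈B y∈B x≢y =
    decidable-stable (T? (adj G x y)) λ x≁y → no-separating-cut (mvd x y x≢y x≁y)
    where
    no-separating-cut : ¬ Σ (VSet n) λ S → IsVertexCut G x y S × Monochromatic c S
    no-separating-cut (_ , cut , monochromatic) = subsingleton-not-cut nonsep x∈B y∈B
      (monochromatic-subsingleton (surjective⇒injective c surjective) monochromatic) cut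

  ∩∁-monoˡ : ∀ {A B : VSet n} {w} → A ⊆ B → A ∩ ∁ ｛ w ｝ ⊆ B ∩ ∁ ｛ w ｝
  ∩∁-monoˡ A⊆B (t∈A , t≢w) = A⊆B t∈A , t≢w

  cycle-nonseparable : ∀ {p x z} (Q : Reach G (∁ ｛ p ｝) x z) → Simple Q → Adj G p x → Adj G p z →
    Nonseparable G (｛ p ｝ ∪ Vertices Q)
  cycle-nonseparable {p} {z = z} Q simple p~x p~z =
    ((p , inj₁ refl) , λ u v u∈C v∈C → to-p u∈C ++ reverse (to-p v∈C)) , nocut
    where
    C : VSet n
    C = ｛ p ｝ ∪ Vertices Q

    p∉Q : ∀ {w} → w ∈ʷ Q → p ≢ w
    p∉Q = Vertices⊆ Q

    to-p : ∀ {u} → u ∈ C → Reach G C u p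
    to-p (inj₁ refl) = here (inj₁ refl)
    to-p (inj₂ u∈Q)  = snoc (Reach-mono inj₂ (suffix Q u∈Q)) (Adj-sym p~z) (inj₁ refl)

    Q⊆C : ∀ {w} → Vertices Q ∩ ∁ ｛ w ｝ ⊆ C ∩ ∁ ｛ w ｝
    Q⊆C = ∩∁-monoˡ {A = Vertices Q} {B = C} inj₂

    to-p-avoiding : ∀ {u w} → w ∈ʷ Q → u ∈ C → u ≢ w → Reach G (C ∩ ∁ ｛ w ｝) u p
    to-p-avoiding w∈Q (inj₁ refl) _ = here (inj₁ refl , p∉Q w∈Q ∘ sym)
    to-p-avoiding w∈Q (inj₂ u∈Q) u≢w with reach-end-avoiding Q simple u∈Q w∈Q u≢w
    ... | inj₁ u⇝x = snoc (Reach-mono Q⊆C u⇝x) (Adj-sym p~x) (inj₁ refl , p∉Q w∈Q ∘ sym)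
    ... | inj₂ u⇝z = snoc (Reach-mono Q⊆C u⇝z) (Adj-sym p~z) (inj₁ refl , p∉Q w∈Q ∘ sym)

    to-z-avoiding-p : ∀ {u} → u ∈ C → u ≢ p → Reach G (C ∩ ∁ ｛ p ｝) u z
    to-z-avoiding-p (inj₁ refl) u≢p = ⊥-elim (u≢p refl)
    to-z-avoiding-p (inj₂ u∈Q)  _   = Reach-mono (λ t∈Q → inj₂ t∈Q , p∉Q t∈Q) (suffix Q u∈Q)

    nocut : NoCutVertexOn G C
    nocut w (inj₁ refl) u v u∈C v∈C u≢w v≢w =
      to-z-avoiding-p u∈C u≢w ++ reverse (to-z-avoiding-p v∈C v≢w)
    nocut w (inj₂ w∈Q)  u v u∈C v∈C u≢w v≢w =
      to-p-avoiding w∈Q u∈C u≢w ++ reverse (to-p-avoiding w∈Q v∈C v≢w)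

  -- Ranging over Bool-valued sets keeps this union in Set; inside a proof of ⊥ every vertex
  -- set may be taken decidable (¬¬-decidable), so no nonseparable set is missed.
  BlockThrough : Fin n → Fin n → VSet n
  BlockThrough p q v = Σ (Fin n → Bool) λ D → Nonseparable G (T ∘ D) × T (D p) × T (D q) × T (D v)

  ∈BlockThrough : ∀ {B p q v} → Decidable B → Nonseparable G B → p ∈ B → q ∈ B → v ∈ B →
    v ∈ BlockThrough p q
  ∈BlockThrough {B} B? nonsep p∈B q∈B v∈B =
    isYes ∘ B? , Nonseparable-resp-≐ (B⊆D , D⊆B) nonsep , B⊆D p∈B , B⊆D q∈B , B⊆D v∈B
    where
    B⊆D : B ⊆ T ∘ isYes ∘ B?
    B⊆D {t} = fromWitness {a? = B? t}

    D⊆B : T ∘ isYes ∘ B? ⊆ B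
    D⊆B {t} = toWitness {a? = B? t}

  BlockThrough-isBlock : ∀ {p q} → p ≢ q → p ∈ BlockThrough p q → Decidable (BlockThrough p q) →
    IsBlock G (BlockThrough p q)
  BlockThrough-isBlock {p} {q} p≢q p∈P@(Dp , nonsepDp , pDp , qDp , _) P? =
    ((((p , p∈P) , λ u v u∈P v∈P → to-p u∈P ++ reverse (to-p v∈P)) , nocut) , maximal)
    where
    P : VSet n
    P = BlockThrough p q

    q∈P : q ∈ P
    q∈P = Dp , nonsepDp , pDp , qDp , qDp

    to-p : ∀ {u} → u ∈ P → Reach G P u p
    to-p (D , nonsepD@((_ , conn) , _) , pD , qD , uD) =
      Reach-mono (λ tD → D , nonsepD , pD , qD , tD) (conn _ p uD pD)

    end∈ : ∀ {D : Fin n → Bool} {h} → h ≡ p ⊎ h ≡ q → T (D p) → T (D q) → T (D h)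
    end∈ (inj₁ refl) pD _  = pD
    end∈ (inj₂ refl) _  qD = qD

    to-end-avoiding : ∀ {h u w} → h ≡ p ⊎ h ≡ q → h ≢ w → u ∈ P → u ≢ w →
      Reach G (P ∩ ∁ ｛ w ｝) u h
    to-end-avoiding {h} {u} {w} h∈pq h≢w (D , nonsepD@((_ , conn) , nocutD) , pD , qD , uD) u≢w
      with T? (D w)
    ... | yes wD = Reach-mono (∩∁-monoˡ {A = T ∘ D} (λ tD → D , nonsepD , pD , qD , tD))
                     (nocutD w wD u h uD (end∈ h∈pq pD qD) u≢w h≢w)
    ... | no ¬wD = Reach-mono (λ tD → (D , nonsepD , pD , qD , tD) , λ { refl → ¬wD tD })
                     (conn u h uD (end∈ h∈pq pD qD))

    nocut : NoCutVertexOn G P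
    nocut w _ u v u∈P v∈P u≢w v≢w with p ≟ᶠ w
    ... | no p≢w   = to-end-avoiding (inj₁ refl) p≢w u∈P u≢w
                       ++ reverse (to-end-avoiding (inj₁ refl) p≢w v∈P v≢w)
    ... | yes refl = to-end-avoiding (inj₂ refl) q≢p u∈P u≢w
                       ++ reverse (to-end-avoiding (inj₂ refl) q≢p v∈P v≢w)
      where
      q≢p : q ≢ p
      q≢p = p≢q ∘ sym

    maximal : ∀ B → P ⊆ B → Nonseparable G B → B ⊆ P
    maximal B P⊆B nonsepB {v} v∈B with P? v
    ... | yes v∈P = v∈P
    ... | no v∉P  = ⊥-elim (¬¬-decidable B λ B? →
                      v∉P (∈BlockThrough B? nonsepB (P⊆B p∈P) (P⊆B q∈P) v∈B))

  module _ (blocks-complete : BlocksComplete) where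

    -- Via the block through the edge p z, which contains the cycle p x ⋯ z p.
    neighbours-adjacent : ∀ {p x z} → Adj G p x → Adj G p z → x ≢ z → Reach G (∁ ｛ p ｝) x z →
      Adj G x z
    neighbours-adjacent {p} {x} {z} p~x p~z x≢z x⇝z =
      decidable-stable (T? (adj G x z)) λ x≁z → ¬¬-decidable (BlockThrough p z) λ P? →
        x≁z (blocks-complete _ (BlockThrough-isBlock p≢z (in-block (inj₁ refl)) P?)
               x z (in-block (inj₂ (source-∈ʷ Q))) (in-block (inj₂ (target-∈ʷ Q))) x≢z)
      where
      Q : Reach G (∁ ｛ p ｝) x z
      Q = proj₁ (simplify x⇝z)

      p≢z : p ≢ z
      p≢z refl = Adj-irrefl p~z

      in-block : ∀ {v} → v ∈ ｛ p ｝ ∪ Vertices Q → v ∈ BlockThrough p z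
      in-block = ∈BlockThrough ((p ≟ᶠ_) ∪? (_∈ʷ? Q))
                   (cycle-nonseparable Q (proj₂ (simplify x⇝z)) p~x p~z)
                   (inj₁ refl) (inj₂ (target-∈ʷ Q))

  -- The step x ∼ p ∼ q, x ≁ q, at which a simple x–y path first leaves the neighbourhood of x.
  record Departure (x y : Fin n) : Set where
    field
      {p q} : Fin n
      x~p   : Adj G x p
      p~q   : Adj G p q
      x≁q   : ¬ Adj G x q
      x≢q   : x ≢ q
      q⇝y   : Reach G (∁ ｛ p ｝) q y

  departure-along : ∀ {x y p} → ¬ Adj G x y → Adj G x p → (r : Reach G U p y) → Simple r →
    x ∉ Vertices r → Departure x y
  departure-along x≁y x~p (here _) _ _ = ⊥-elim (x≁y x~p)
  departure-along {x} x≁y x~p (step {_} {q} _ p~q r) (p∉r , simple) x∉ with T? (adj G x q)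
  ... | yes x~q = departure-along x≁y x~q r simple (x∉ ∘ inj₂)
  ... | no x≁q  = record
    { x~p = x~p ; p~q = p~q ; x≁q = x≁q
    ; x≢q = λ { refl → x∉ (inj₂ (source-∈ʷ r)) }
    ; q⇝y = restrict r λ t∈r → λ { refl → p∉r t∈r }
    }

  departure : ∀ {x y} → Connected G → x ≢ y → ¬ Adj G x y → Departure x y
  departure {x} {y} (_ , conn) x≢y x≁y with simplify (conn x y _ _)
  ... | here _ , _                  = ⊥-elim (x≢y refl)
  ... | step _ x~p r , (x∉r , simple) = departure-along x≁y x~p r simple x∉r

  departure-separates : BlocksComplete → ∀ {x y} (d : Departure x y) →
    IsVertexCut G x y ｛ Departure.p d ｝
  departure-separates blocks-complete d =
    (λ { refl → Adj-irrefl x~p }) , target-∈ q⇝y ,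
    λ x⇝y → x≁q (neighbours-adjacent blocks-complete (Adj-sym x~p) p~q x≢q (x⇝y ++ reverse q⇝y))
    where open Departure d

  blocks-complete⇒mvd : Connected G → BlocksComplete → IsMVD G n
  blocks-complete⇒mvd connected blocks-complete =
    ((λ v → v) , (λ v → v , λ v′≡v → v′≡v) , identity-mvd) ,
    λ _ (c , surjective , _) → surjective⇒≤ c surjective
    where
    identity-mvd : IsMVDColoring G (λ v → v)
    identity-mvd x y x≢y x≁y = ｛ Departure.p d ｝ , departure-separates blocks-complete d ,
                               Departure.p d , λ _ p≡v → sym p≡v
      where d = departure connected x≢y x≁y

theorem3p3 : ∀ (n : ℕ) (G : Graph n) → Connected G →
    (IsMVD G n ⇔ (∀ B → IsBlock G B → CompleteOn G B))
theorem3p3 n G connected = mk⇔ (mvd⇒blocks-complete G) (blocks-complete⇒mvd G connected)
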